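{- Let $n\ge5$ be odd, $T=\langle n,3n-2,3n-1\rangle$, $\mathrm F(T)=\max(\mathbb Z\setminus T)$ and $S=T\cup\{\mathrm F(T)\}=\langle n,3n-2,3n-1,\mathrm F(T)\rangle$. Let $L\subseteq\mathbb N^3$ be an \textsf{L}-shape associated with $S$, let $\mathbf s=3n+(3n-2)=2(3n-1)$, let $i\in\{3,\dots,\frac{n-1}{2}\}$ and $\mathbf s_i'=3(i-1)n+(i-1)(3n-2)$. Then: 1) $\mathsf Z(\mathbf s)=\{(3,1,0),(0,0,2)\}$; 2) if $(3,1,0)\in L$, then $L\cap\mathsf Z(\mathbf s_i')=\{(3(i-1),i-1,0)\}$; 3) if $(0,0,2)\in L$, then $L\cap\mathsf Z(\mathbf s_i')=\{(0,0,2(i-1))\}$. In particular, $L\cap\mathsf Z(\mathbf s_i')\subseteq\{(3(i-1),i-1,0),(0,0,2(i-1))\}$.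
   Context: For $m\in S\setminus\{0\}$, $\mathrm{Ap}(S,m)=\{s\in S: s-m\notin S\}$. For $s\in T$, $\mathsf Z(s)=\{(x,y,z)\in\mathbb N^3: xn+y(3n-2)+z(3n-1)=s\}$. A set $L\subseteq\mathbb N^3$ is an \textsf{L}-shape associated with $S$ if (C1) the map $(x,y,z)\mapsto xn+y(3n-2)+z(3n-1)$ is a bijection from $L$ onto $\mathrm{Ap}(S,\mathrm F(T))$ (equivalently $\#(\mathsf Z(c)\cap L)=1$ for all $c\in\mathrm{Ap}(S,\mathrm F(T))$), and (C2) whenever $u\in L$ and $v\in\mathbb N^3$ with $v\le u$ componentwise, then $v\in L$. -}

module Defs where

open import Data.Nat using (ℕ; _+_; _*_; _∸_; _<_)
open import Data.Product using (Σ; ∃; _×_; _,_)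
open import Data.Sum using (_⊎_)
open import Relation.Nullary using (¬_)
open import Relation.Binary.PropositionalEquality using (_≡_)

ℕ³ : Set
ℕ³ = ℕ × ℕ × ℕ

_≤³_ : ℕ³ → ℕ³ → Set
(a , b , c) ≤³ (x , y , z) = (a Data.Nat.≤ x) × (b Data.Nat.≤ y) × (c Data.Nat.≤ z)

φ : ℕ → ℕ³ → ℕ
φ n (x , y , z) = x * n + y * (3 * n ∸ 2) + z * (3 * n ∸ 1)

Z : ℕ → ℕ → ℕ³ → Set
Z n s u = φ n u ≡ s

InT : ℕ → ℕ → Set
InT n s = ∃ λ u → Z n s u

IsFrobeniusT : ℕ → ℕ → Set
IsFrobeniusT n f = ¬ InT n f × (∀ m → f < m → InT n m)

InS : ℕ → ℕ → ℕ → Set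
InS n f s = InT n s ⊎ s ≡ f

-- membership in Ap(S, m) = {s ∈ S : s - m ∉ S} (s - m taken in ℤ; negatives are never in S)
InAp : ℕ → ℕ → ℕ → ℕ → Set
InAp n f m s = InS n f s × ¬ (∃ λ d → d + m ≡ s × InS n f d)

record IsLShape (n f : ℕ) (L : ℕ³ → Set) : Set where
  field
    into       : ∀ u → L u → InAp n f f (φ n u)
    injective  : ∀ u v → L u → L v → φ n u ≡ φ n v → u ≡ v
    surjective : ∀ c → InAp n f f c → ∃ λ u → L u × φ n u ≡ c
    downClosed : ∀ u v → L u → v ≤³ u → L v

-- Write n = 3 + 2q.  A factorization u = (x, y, z) satisfies φ u = n · weight u − deficit u
-- with weight u = x + 3(y + z) and deficit u = 2y + z ≤ 2(y + z), so by division with remainder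
-- an element n·Q − j with j < n lies in T exactly when 3⌈j/2⌉ ≤ Q.  This pins down
-- F(T) = (3q + 1)n + 2 and shows that k𝐬 − F(T) ∉ S for k ≤ q, so k𝐬 ∈ Ap(S, F(T)).
-- The same division argument shows that the factorizations of k𝐬 with 2k < n are exactly
-- (3a, a, 2b) with a + b = k.  As (3,1,0) and (0,0,2) both factor 𝐬, an L-shape contains at
-- most one of them, so by downward closure it contains no factorization of k𝐬 with a, b ≥ 1;
-- the factorization of k𝐬 that L must contain by (C1) is then the one on the side L has chosen.

module Submission where

open import Defs
open import Data.Nat using (ℕ; zero; suc; _+_; _*_; _∸_; _≤_; _<_; _%_; _/_; z≤n; s≤s; s≤s⁻¹; ⌊_/2⌋)
open import Data.Nat.Properties
open import Data.Nat.DivMod using (m≡m%n+[m/n]*n; m%n<n)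
open import Data.Nat.Tactic.RingSolver using (solve-∀)
open import Data.Product using (∃; _×_; _,_)
open import Data.Sum using (_⊎_; inj₁; inj₂)
open import Data.Empty using (⊥; ⊥-elim)
open import Relation.Binary.PropositionalEquality
open import Relation.Binary.Definitions using (tri<; tri≈; tri>)
open import Relation.Nullary using (¬_)

weight : ℕ³ → ℕ
weight (x , y , z) = x + 3 * (y + z)

deficit : ℕ³ → ℕ
deficit (x , y , z) = 2 * y + z

φ+deficit≡n*weight : ∀ {n} → 1 ≤ n → ∀ u → φ n u + deficit u ≡ n * weight u
φ+deficit≡n*weight {n} 1≤n (x , y , z) = begin
  x * n + y * (3 * n ∸ 2) + z * (3 * n ∸ 1) + (2 * y + z)
    ≡⟨ regroup x y z n (3 * n ∸ 2) (3 * n ∸ 1) ⟩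
  x * n + y * (3 * n ∸ 2 + 2) + z * (3 * n ∸ 1 + 1)
    ≡⟨ cong₂ (λ a b → x * n + y * a + z * b) (m∸n+n≡m (≤-trans (n≤1+n 2) 3≤3n)) (m∸n+n≡m (≤-trans (s≤s z≤n) 3≤3n)) ⟩
  x * n + y * (3 * n) + z * (3 * n)
    ≡⟨ collect x y z n ⟩
  n * (x + 3 * (y + z)) ∎
  where
  open ≡-Reasoning
  3≤3n : 3 ≤ 3 * n
  3≤3n = *-monoʳ-≤ 3 1≤n
  regroup : ∀ x y z n a b → x * n + y * a + z * b + (2 * y + z) ≡ x * n + y * (a + 2) + z * (b + 1)
  regroup = solve-∀
  collect : ∀ x y z n → x * n + y * (3 * n) + z * (3 * n) ≡ n * (x + 3 * (y + z))
  collect = solve-∀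

quotient-split : ∀ {n q Q j w} → j < n → n * q + j ≡ n * Q + w → ∃ λ m → q ≡ Q + m × w ≡ n * m + j
quotient-split {n} {q} {Q} {j} {w} j<n eq with ≤-<-connex Q q
... | inj₁ Q≤q with m≤n⇒∃[o]m+o≡n Q≤q
...   | m , refl = m , refl , +-cancelˡ-≡ (n * Q) w (n * m + j) (begin
  n * Q + w            ≡⟨ sym eq ⟩
  n * (Q + m) + j      ≡⟨ cong (_+ j) (*-distribˡ-+ n Q m) ⟩
  n * Q + n * m + j    ≡⟨ +-assoc (n * Q) (n * m) j ⟩
  n * Q + (n * m + j)  ∎)
  where open ≡-Reasoning
quotient-split {n} {q} {Q} {j} {w} j<n eq | inj₂ q<Q = ⊥-elim (<-irrefl eq (begin-strict
  n * q + j      <⟨ +-monoʳ-< (n * q) j<n ⟩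
  n * q + n      ≡⟨ trans (+-comm (n * q) n) (sym (*-suc n q)) ⟩
  n * suc q      ≤⟨ *-monoʳ-≤ n q<Q ⟩
  n * Q          ≤⟨ m≤m+n (n * Q) w ⟩
  n * Q + w      ∎))
  where open ≤-Reasoning

spread : ℕ³ → ℕ
spread (x , y , z) = y + z

deficit≤2*spread : ∀ u → deficit u ≤ 2 * spread u
deficit≤2*spread (x , y , z) = subst (2 * y + z ≤_) (sym (*-distribˡ-+ 2 y z)) (+-monoʳ-≤ (2 * y) (m≤n*m z 2))

3*spread≤weight : ∀ u → 3 * spread u ≤ weight u
3*spread≤weight (x , y , z) = m≤n+m (3 * (y + z)) x

-- The element n(3c − t) − j, stated without truncated subtraction.
φ+n*t+j≢n*3c : ∀ {n t j c} → 2 ≤ n → 1 ≤ t → j < n → 2 * c ≤ suc j →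
  ∀ u → φ n u + n * t + j ≢ n * (3 * c)
φ+n*t+j≢n*3c {n} {t} {j} {c} 2≤n 1≤t j<n 2c≤1+j u eq = absurd (quotient-split j<n lifted)
  where
  open ≤-Reasoning
  lifted : n * (weight u + t) + j ≡ n * (3 * c) + deficit u
  lifted = begin-equality
    n * (weight u + t) + j           ≡⟨ cong (_+ j) (*-distribˡ-+ n (weight u) t) ⟩
    n * weight u + n * t + j         ≡⟨ cong (λ a → a + n * t + j) (sym (φ+deficit≡n*weight (≤-trans (s≤s z≤n) 2≤n) u)) ⟩
    φ n u + deficit u + n * t + j    ≡⟨ move (φ n u) (deficit u) (n * t) j ⟩
    φ n u + n * t + j + deficit u    ≡⟨ cong (_+ deficit u) eq ⟩
    n * (3 * c) + deficit u          ∎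
    where
    move : ∀ a b c d → a + b + c + d ≡ a + c + d + b
    move = solve-∀
  absurd : (∃ λ m → weight u + t ≡ 3 * c + m × deficit u ≡ n * m + j) → ⊥
  absurd (m , weight+t≡3c+m , deficit≡nm+j) = <-irrefl refl (begin-strict
    suc (2 * m + j)        ≤⟨ s≤s (+-monoˡ-≤ j (*-monoˡ-≤ m 2≤n)) ⟩
    suc (n * m + j)        ≡⟨ cong suc (sym deficit≡nm+j) ⟩
    suc (deficit u)        ≤⟨ s≤s (deficit≤2*spread u) ⟩
    suc (2 * spread u)     <⟨ ≤-refl ⟩
    2 + 2 * spread u       ≡⟨ sym (*-suc 2 (spread u)) ⟩
    2 * suc (spread u)     ≤⟨ *-monoʳ-≤ 2 spread<c+m ⟩
    2 * (c + m)            ≡⟨ *-distribˡ-+ 2 c m ⟩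
    2 * c + 2 * m          ≤⟨ +-monoˡ-≤ (2 * m) 2c≤1+j ⟩
    suc j + 2 * m          ≡⟨ cong suc (+-comm j (2 * m)) ⟩
    suc (2 * m + j)        ∎)
    where
    spread<c+m : spread u < c + m
    spread<c+m = *-cancelˡ-< 3 (spread u) (c + m) (begin-strict
      3 * spread u       ≤⟨ 3*spread≤weight u ⟩
      weight u           <⟨ m<m+n (weight u) 1≤t ⟩
      weight u + t       ≡⟨ weight+t≡3c+m ⟩
      3 * c + m          ≤⟨ +-monoʳ-≤ (3 * c) (m≤n*m m 3) ⟩
      3 * c + 3 * m      ≡⟨ sym (*-distribˡ-+ 3 c m) ⟩
      3 * (c + m)        ∎)

≤2c⇒2y+z : ∀ j c → j ≤ 2 * c → ∃ λ y → ∃ λ z → 2 * y + z ≡ j × y + z ≤ c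
≤2c⇒2y+z zero          c       _    = 0 , 0 , refl , z≤n
≤2c⇒2y+z (suc zero)    (suc c) _    = 0 , 1 , refl , s≤s z≤n
≤2c⇒2y+z (suc (suc j)) (suc c) j+2≤2c+2
  with ≤2c⇒2y+z j c (s≤s⁻¹ (s≤s⁻¹ (subst (suc (suc j) ≤_) (*-suc 2 c) j+2≤2c+2)))
... | y , z , refl , y+z≤c = suc y , z , cong (_+ z) (*-suc 2 y) , s≤s y+z≤c

s+j≡n*Q⇒s∈T : ∀ {n s j c Q} → 1 ≤ n → j ≤ 2 * c → 3 * c ≤ Q → s + j ≡ n * Q → InT n s
s+j≡n*Q⇒s∈T {n} {s} {j} {c} 1≤n j≤2c 3c≤Q s+j≡nQ with ≤2c⇒2y+z j c j≤2c
... | y , z , refl , y+z≤c with m≤n⇒∃[o]m+o≡n (≤-trans (*-monoʳ-≤ 3 y+z≤c) 3c≤Q)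
...   | x , refl = (x , y , z) , +-cancelʳ-≡ (2 * y + z) (φ n (x , y , z)) s (begin
  φ n (x , y , z) + (2 * y + z)   ≡⟨ φ+deficit≡n*weight 1≤n (x , y , z) ⟩
  n * (x + 3 * (y + z))           ≡⟨ cong (n *_) (+-comm x (3 * (y + z))) ⟩
  n * (3 * (y + z) + x)           ≡⟨ sym s+j≡nQ ⟩
  s + (2 * y + z)                 ∎)
  where open ≡-Reasoning

frobenius-unique : ∀ {n f g} → IsFrobeniusT n f → IsFrobeniusT n g → f ≡ g
frobenius-unique {f = f} {g} (f∉T , >f∈T) (g∉T , >g∈T) with <-cmp f g
... | tri< f<g _ _ = ⊥-elim (g∉T (>f∈T g f<g))
... | tri≈ _ f≡g _ = f≡g
... | tri> _ _ g<f = ⊥-elim (f∉T (>g∈T f g<f))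

InT-+-multiple : ∀ {n s} → InT n s → ∀ a → InT n (s + a * n)
InT-+-multiple {n} ((x , y , z) , φu≡s) a =
  (x + a , y , z) , trans (shift x a y z n (3 * n ∸ 2) (3 * n ∸ 1)) (cong (_+ a * n) φu≡s)
  where
  shift : ∀ x a y z n b c → (x + a) * n + y * b + z * c ≡ x * n + y * b + z * c + a * n
  shift = solve-∀

-- k·𝐬 with 𝐬 = 3n + (3n − 2); the paper's 𝐬ᵢ′ is 𝐬 n (i − 1).
𝐬 : ℕ → ℕ → ℕ
𝐬 n k = 3 * k * n + k * (3 * n ∸ 2)

φ[3k,k,0]≡𝐬 : ∀ n k → φ n (3 * k , k , 0) ≡ 𝐬 n k
φ[3k,k,0]≡𝐬 n k = +-identityʳ (𝐬 n k)

𝐬+2k≡n*6k : ∀ {n} → 1 ≤ n → ∀ k → 𝐬 n k + 2 * k ≡ n * (6 * k)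
𝐬+2k≡n*6k {n} 1≤n k = begin
  𝐬 n k + 2 * k                                ≡⟨ cong₂ _+_ (sym (φ[3k,k,0]≡𝐬 n k)) (sym (+-identityʳ (2 * k))) ⟩
  φ n (3 * k , k , 0) + deficit (3 * k , k , 0)  ≡⟨ φ+deficit≡n*weight 1≤n (3 * k , k , 0) ⟩
  n * (3 * k + 3 * (k + 0))                    ≡⟨ cong (n *_) (six k) ⟩
  n * (6 * k)                                  ∎
  where
  open ≡-Reasoning
  six : ∀ k → 3 * k + 3 * (k + 0) ≡ 6 * k
  six = solve-∀

φ[0,0,2k]≡𝐬 : ∀ {n} → 1 ≤ n → ∀ k → φ n (0 , 0 , 2 * k) ≡ 𝐬 n k
φ[0,0,2k]≡𝐬 {n} 1≤n k = +-cancelʳ-≡ (2 * k) (φ n (0 , 0 , 2 * k)) (𝐬 n k) (begin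
  φ n (0 , 0 , 2 * k) + 2 * k   ≡⟨ φ+deficit≡n*weight 1≤n (0 , 0 , 2 * k) ⟩
  n * (3 * (2 * k))             ≡⟨ cong (n *_) (six k) ⟩
  n * (6 * k)                   ≡⟨ sym (𝐬+2k≡n*6k 1≤n k) ⟩
  𝐬 n k + 2 * k                 ∎)
  where
  open ≡-Reasoning
  six : ∀ k → 3 * (2 * k) ≡ 6 * k
  six = solve-∀

3*deficit≤2*weight : ∀ u → 3 * deficit u ≤ 2 * weight u
3*deficit≤2*weight (x , y , z) = subst (3 * (2 * y + z) ≤_) (sym (expand x y z)) (m≤m+n _ _)
  where
  expand : ∀ x y z → 2 * (x + 3 * (y + z)) ≡ 3 * (2 * y + z) + (2 * x + 3 * z)
  expand = solve-∀

weight≡6k∧deficit≡2k⇒shape : ∀ {k} x y z → x + 3 * (y + z) ≡ 6 * k → 2 * y + z ≡ 2 * k →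
  ∃ λ a → ∃ λ b → a + b ≡ k × (x , y , z) ≡ (3 * a , a , 2 * b)
weight≡6k∧deficit≡2k⇒shape {k} x y z weight≡6k deficit≡2k
  with m≤n⇒∃[o]m+o≡n {y} {k} (*-cancelˡ-≤ 2 (subst (2 * y ≤_) deficit≡2k (m≤m+n (2 * y) z)))
... | b , refl = y , b , refl , cong₂ (λ x z → x , y , z) x≡3y z≡2b
  where
  open ≡-Reasoning
  z≡2b : z ≡ 2 * b
  z≡2b = +-cancelˡ-≡ (2 * y) z (2 * b) (trans deficit≡2k (*-distribˡ-+ 2 y b))
  x≡3y : x ≡ 3 * y
  x≡3y = +-cancelʳ-≡ (3 * (y + z)) x (3 * y) (begin
    x + 3 * (y + z)        ≡⟨ weight≡6k ⟩
    6 * (y + b)            ≡⟨ regroup y b ⟩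
    3 * y + 3 * (y + 2 * b) ≡⟨ cong (λ z → 3 * y + 3 * (y + z)) (sym z≡2b) ⟩
    3 * y + 3 * (y + z)    ∎)
    where
    regroup : ∀ y b → 6 * (y + b) ≡ 3 * y + 3 * (y + 2 * b)
    regroup = solve-∀

factorizations-𝐬 : ∀ {n k} → 2 * k < n → ∀ u → Z n (𝐬 n k) u →
  ∃ λ a → ∃ λ b → a + b ≡ k × u ≡ (3 * a , a , 2 * b)
factorizations-𝐬 {n} {k} 2k<n u φu≡𝐬 = from-split u (quotient-split 2k<n lifted)
  where
  1≤n : 1 ≤ n
  1≤n = ≤-trans (s≤s z≤n) 2k<n
  lifted : n * weight u + 2 * k ≡ n * (6 * k) + deficit u
  lifted = begin
    n * weight u + 2 * k          ≡⟨ cong (_+ 2 * k) (sym (φ+deficit≡n*weight 1≤n u)) ⟩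
    φ n u + deficit u + 2 * k     ≡⟨ swap (φ n u) (deficit u) (2 * k) ⟩
    φ n u + 2 * k + deficit u     ≡⟨ cong (λ a → a + 2 * k + deficit u) φu≡𝐬 ⟩
    𝐬 n k + 2 * k + deficit u     ≡⟨ cong (_+ deficit u) (𝐬+2k≡n*6k 1≤n k) ⟩
    n * (6 * k) + deficit u       ∎
    where
    open ≡-Reasoning
    swap : ∀ a b c → a + b + c ≡ a + c + b
    swap = solve-∀
  from-split : ∀ u → (∃ λ m → weight u ≡ 6 * k + m × deficit u ≡ n * m + 2 * k) →
    ∃ λ a → ∃ λ b → a + b ≡ k × u ≡ (3 * a , a , 2 * b)
  from-split (x , y , z) (zero , weight≡ , deficit≡) =
    weight≡6k∧deficit≡2k⇒shape x y z (trans weight≡ (+-identityʳ (6 * k)))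
      (trans deficit≡ (cong (_+ 2 * k) (*-zeroʳ n)))
  from-split u (suc m , weight≡ , deficit≡) = ⊥-elim (<-irrefl refl (begin-strict
    2 * (6 * k + suc m)            ≡⟨ expand k m ⟩
    6 * k + (6 * k + 2) + 2 * m    <⟨ +-monoˡ-< (2 * m) (+-monoʳ-< (6 * k) 6k+2<3n) ⟩
    6 * k + 3 * n + 2 * m          ≤⟨ +-monoʳ-≤ (6 * k + 3 * n) (*-monoˡ-≤ m 2≤3n) ⟩
    6 * k + 3 * n + 3 * n * m      ≡⟨ collect k n m ⟩
    3 * (n * suc m + 2 * k)        ≡⟨ cong (3 *_) (sym deficit≡) ⟩
    3 * deficit u                  ≤⟨ 3*deficit≤2*weight u ⟩
    2 * weight u                   ≡⟨ cong (2 *_) weight≡ ⟩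
    2 * (6 * k + suc m)            ∎))
    where
    open ≤-Reasoning
    expand : ∀ k m → 2 * (6 * k + suc m) ≡ 6 * k + (6 * k + 2) + 2 * m
    expand = solve-∀
    collect : ∀ k n m → 6 * k + 3 * n + 3 * n * m ≡ 3 * (n * suc m + 2 * k)
    collect = solve-∀
    6k+2<3n : 6 * k + 2 < 3 * n
    6k+2<3n = subst (_≤ 3 * n) (three k) (*-monoʳ-≤ 3 2k<n)
      where
      three : ∀ k → 3 * suc (2 * k) ≡ suc (6 * k + 2)
      three = solve-∀
    2≤3n : 2 ≤ 3 * n
    2≤3n = ≤-trans (n≤1+n 2) (*-monoʳ-≤ 3 1≤n)

𝐬[1] : ∀ n → 𝐬 n 1 ≡ 3 * n + (3 * n ∸ 2)
𝐬[1] n = cong (3 * n +_) (+-identityʳ (3 * n ∸ 2))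

factorizations-𝐬₁ : ∀ {n} → 2 < n → ∀ u →
  (Z n (3 * n + (3 * n ∸ 2)) u → u ≡ (3 , 1 , 0) ⊎ u ≡ (0 , 0 , 2)) ×
  (u ≡ (3 , 1 , 0) ⊎ u ≡ (0 , 0 , 2) → Z n (3 * n + (3 * n ∸ 2)) u)
factorizations-𝐬₁ {n} 2<n u = (λ Zu → classify (factorizations-𝐬 2<n u (trans Zu (sym (𝐬[1] n))))) , realise
  where
  classify : (∃ λ a → ∃ λ b → a + b ≡ 1 × u ≡ (3 * a , a , 2 * b)) → u ≡ (3 , 1 , 0) ⊎ u ≡ (0 , 0 , 2)
  classify (0 , 1 , refl , u≡) = inj₂ u≡
  classify (1 , 0 , refl , u≡) = inj₁ u≡
  realise : u ≡ (3 , 1 , 0) ⊎ u ≡ (0 , 0 , 2) → Z n (3 * n + (3 * n ∸ 2)) u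
  realise (inj₁ refl) = trans (φ[3k,k,0]≡𝐬 n 1) (𝐬[1] n)
  realise (inj₂ refl) = trans (φ[0,0,2k]≡𝐬 (≤-trans (s≤s z≤n) 2<n) 1) (𝐬[1] n)

-- F(T) for n = 3 + 2q; it equals (n − 1)(3n − 4)/2.
frobeniusNumber : ℕ → ℕ
frobeniusNumber q = (3 * q + 1) * (3 + 2 * q) + 2

module _ (q : ℕ) where
  private
    n = 3 + 2 * q
    F = frobeniusNumber q

  frobeniusNumber∉T : ¬ InT n F
  frobeniusNumber∉T (u , φu≡F) =
    φ+n*t+j≢n*3c {t = 1} {j = 1 + 2 * q} {c = suc q} (s≤s (s≤s z≤n)) ≤-refl
      (s≤s (s≤s (n≤1+n (2 * q)))) (≤-reflexive (*-suc 2 q)) u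
      (trans (cong (λ s → s + n * 1 + (1 + 2 * q)) φu≡F) (identity q))
    where
    identity : ∀ q → (3 * q + 1) * (3 + 2 * q) + 2 + (3 + 2 * q) * 1 + (1 + 2 * q) ≡ (3 + 2 * q) * (3 * suc q)
    identity = solve-∀

  -- F + 1 + r is n(3q + 2) − (2q − r) if r ≤ 2q, and n(3q + 3) − (4q + 3 − r) otherwise.
  frobeniusNumber+1+r∈T : ∀ r → r < n → InT n (suc F + r)
  frobeniusNumber+1+r∈T r r<n with ≤-<-connex r (2 * q)
  ... | inj₁ r≤2q with m≤n⇒∃[o]m+o≡n r≤2q
  ...   | j , r+j≡2q = s+j≡n*Q⇒s∈T {j = j} {c = q} (s≤s z≤n) (m+n≤o⇒n≤o r (≤-reflexive r+j≡2q)) (m≤m+n (3 * q) 2) (begin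
    suc F + r + j          ≡⟨ cong suc (+-assoc F r j) ⟩
    suc F + (r + j)        ≡⟨ cong (λ m → suc F + m) r+j≡2q ⟩
    suc F + 2 * q          ≡⟨ identity q ⟩
    n * (3 * q + 2)        ∎)
    where
    open ≡-Reasoning
    identity : ∀ q → suc ((3 * q + 1) * (3 + 2 * q) + 2) + 2 * q ≡ (3 + 2 * q) * (3 * q + 2)
    identity = solve-∀
  frobeniusNumber+1+r∈T r r<n | inj₂ 2q<r with m≤n⇒∃[o]m+o≡n 2q<r
  ... | e , refl with m≤n⇒∃[o]m+o≡n (m+n≤o⇒n≤o (suc (2 * q)) (s≤s⁻¹ r<n))
  ...   | j , e+j≡2+2q = s+j≡n*Q⇒s∈T {j = j} {c = suc q} (s≤s z≤n) j≤2+2q ≤-refl (begin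
    suc F + (suc (2 * q) + e) + j   ≡⟨ regroup (suc F) (suc (2 * q)) e j ⟩
    suc F + suc (2 * q) + (e + j)   ≡⟨ cong (suc F + suc (2 * q) +_) e+j≡2+2q ⟩
    suc F + suc (2 * q) + (2 + 2 * q) ≡⟨ identity q ⟩
    n * (3 * suc q)                 ∎)
    where
    open ≡-Reasoning
    j≤2+2q : j ≤ 2 * suc q
    j≤2+2q = ≤-trans (m+n≤o⇒n≤o e (≤-reflexive e+j≡2+2q)) (≤-reflexive (sym (*-suc 2 q)))
    regroup : ∀ a b e j → a + (b + e) + j ≡ a + b + (e + j)
    regroup = solve-∀
    identity : ∀ q → suc ((3 * q + 1) * (3 + 2 * q) + 2) + suc (2 * q) + (2 + 2 * q) ≡ (3 + 2 * q) * (3 * suc q)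
    identity = solve-∀

  frobeniusNumber-isFrobenius : IsFrobeniusT n F
  frobeniusNumber-isFrobenius = frobeniusNumber∉T , above
    where
    above : ∀ m → F < m → InT n m
    above m F<m with m≤n⇒∃[o]m+o≡n F<m
    ... | d , refl = subst (InT n) (trans (+-assoc (suc F) (d % n) (d / n * n)) (cong (suc F +_) (sym (m≡m%n+[m/n]*n d n))))
      (InT-+-multiple (frobeniusNumber+1+r∈T (d % n) (m%n<n d n)) (d / n))

  𝐬∈Ap : ∀ {k} → k ≤ q → InAp n F F (𝐬 n k)
  𝐬∈Ap {k} k≤q = inj₁ ((3 * k , k , 0) , φ[3k,k,0]≡𝐬 n k) , 𝐬-F∉S
    where
    1≤n : 1 ≤ n
    1≤n = s≤s z≤n
    𝐬-F∉S : ¬ (∃ λ d → d + F ≡ 𝐬 n k × InS n F d)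
    -- k𝐬 − F = n(3(k + 1) − (3r + 4)) − 2(k + 1), where q = k + r.
    𝐬-F∉S (d , d+F≡𝐬 , inj₁ (u , refl)) with m≤n⇒∃[o]m+o≡n k≤q
    ... | r , k+r≡q = φ+n*t+j≢n*3c {t = 4 + 3 * r} {j = 2 * suc k} {c = suc k} (s≤s (s≤s z≤n)) (s≤s z≤n) j<n (n≤1+n _) u
      (+-cancelʳ-≡ F _ _ (begin
        φ n u + n * (4 + 3 * r) + 2 * suc k + F     ≡⟨ regroup (φ n u) (n * (4 + 3 * r)) k F ⟩
        φ n u + F + 2 * k + (n * (4 + 3 * r) + 2)   ≡⟨ cong (λ s → s + 2 * k + (n * (4 + 3 * r) + 2)) d+F≡𝐬 ⟩
        𝐬 n k + 2 * k + (n * (4 + 3 * r) + 2)       ≡⟨ cong (_+ (n * (4 + 3 * r) + 2)) (𝐬+2k≡n*6k 1≤n k) ⟩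
        n * (6 * k) + (n * (4 + 3 * r) + 2)         ≡⟨ identity n k r ⟩
        n * (3 * suc k) + ((3 * (k + r) + 1) * n + 2) ≡⟨ cong (λ q → n * (3 * suc k) + ((3 * q + 1) * n + 2)) k+r≡q ⟩
        n * (3 * suc k) + F                         ∎))
      where
      open ≡-Reasoning
      j<n : 2 * suc k < n
      j<n = ≤-trans (≤-reflexive (cong suc (*-suc 2 k))) (+-monoʳ-≤ 3 (*-monoʳ-≤ 2 k≤q))
      regroup : ∀ a t k F → a + t + 2 * suc k + F ≡ a + F + 2 * k + (t + 2)
      regroup = solve-∀
      identity : ∀ n k r → n * (6 * k) + (n * (4 + 3 * r) + 2) ≡ n * (3 * suc k) + ((3 * (k + r) + 1) * n + 2)
      identity = solve-∀
    𝐬-F∉S (.F , F+F≡𝐬 , inj₂ refl) = frobeniusNumber∉T ((0 , 0 , k) , +-self-injective (begin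
      φ n (0 , 0 , k) + φ n (0 , 0 , k)   ≡⟨ double k (3 * n ∸ 2) (3 * n ∸ 1) ⟩
      φ n (0 , 0 , 2 * k)                 ≡⟨ φ[0,0,2k]≡𝐬 1≤n k ⟩
      𝐬 n k                               ≡⟨ sym F+F≡𝐬 ⟩
      F + F                               ∎))
      where
      open ≡-Reasoning
      double : ∀ k b c → 0 * n + 0 * b + k * c + (0 * n + 0 * b + k * c) ≡ 0 * n + 0 * b + 2 * k * c
      double = solve-∀
      +-self-injective : ∀ {a b} → a + a ≡ b + b → a ≡ b
      +-self-injective {a} {b} a+a≡b+b = trans (n≡⌊n+n/2⌋ a) (trans (cong ⌊_/2⌋ a+a≡b+b) (sym (n≡⌊n+n/2⌋ b)))

module _ {n f : ℕ} {L : ℕ³ → Set} (isL : IsLShape n f L) (1≤n : 1 ≤ n) where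
  open IsLShape isL

  [3,1,0]∈L⇒[0,0,2]∉L : L (3 , 1 , 0) → ¬ L (0 , 0 , 2)
  [3,1,0]∈L⇒[0,0,2]∉L L310 L002
    with injective _ _ L310 L002 (trans (φ[3k,k,0]≡𝐬 n 1) (sym (φ[0,0,2k]≡𝐬 1≤n 1)))
  ... | ()

  [3a,a,2b]∈L⇒a≡0⊎b≡0 : ∀ a b → L (3 * a , a , 2 * b) → a ≡ 0 ⊎ b ≡ 0
  [3a,a,2b]∈L⇒a≡0⊎b≡0 zero    b       _ = inj₁ refl
  [3a,a,2b]∈L⇒a≡0⊎b≡0 (suc a) zero    _ = inj₂ refl
  [3a,a,2b]∈L⇒a≡0⊎b≡0 (suc a) (suc b) Lu = ⊥-elim ([3,1,0]∈L⇒[0,0,2]∉L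
    (downClosed _ _ Lu (*-monoʳ-≤ 3 (s≤s z≤n) , s≤s z≤n , z≤n))
    (downClosed _ _ Lu (z≤n , z≤n , *-monoʳ-≤ 2 (s≤s z≤n))))

  L∩Z[𝐬]⊆ : ∀ {k} → 2 * k < n → ∀ u → L u → Z n (𝐬 n k) u → u ≡ (3 * k , k , 0) ⊎ u ≡ (0 , 0 , 2 * k)
  L∩Z[𝐬]⊆ {k} 2k<n u Lu Zu with factorizations-𝐬 {k = k} 2k<n u Zu
  ... | a , b , a+b≡k , refl with [3a,a,2b]∈L⇒a≡0⊎b≡0 a b Lu
  ...   | inj₁ refl = inj₂ (cong (λ b → 0 , 0 , 2 * b) a+b≡k)
  ...   | inj₂ refl = inj₁ (cong (λ a → 3 * a , a , 0) (trans (sym (+-identityʳ a)) a+b≡k))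

  module _ {k} (1≤k : 1 ≤ k) (2k<n : 2 * k < n) (𝐬∈Ap : InAp n f f (𝐬 n k)) where

    L∩Z[𝐬]-if-[3,1,0]∈L : L (3 , 1 , 0) → ∀ u →
      (L u × Z n (𝐬 n k) u → u ≡ (3 * k , k , 0)) × (u ≡ (3 * k , k , 0) → L u × Z n (𝐬 n k) u)
    L∩Z[𝐬]-if-[3,1,0]∈L L310 u = ⊆ u , λ { refl → [3k,k,0]∈L , φ[3k,k,0]≡𝐬 n k }
      where
      ⊆ : ∀ u → L u × Z n (𝐬 n k) u → u ≡ (3 * k , k , 0)
      ⊆ u (Lu , Zu) with L∩Z[𝐬]⊆ {k} 2k<n u Lu Zu
      ... | inj₁ u≡ = u≡
      ... | inj₂ refl = ⊥-elim ([3,1,0]∈L⇒[0,0,2]∉L L310 (downClosed _ _ Lu (z≤n , z≤n , *-monoʳ-≤ 2 1≤k)))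
      [3k,k,0]∈L : L (3 * k , k , 0)
      [3k,k,0]∈L with surjective _ 𝐬∈Ap
      ... | v , Lv , Zv = subst L (⊆ v (Lv , Zv)) Lv

    L∩Z[𝐬]-if-[0,0,2]∈L : L (0 , 0 , 2) → ∀ u →
      (L u × Z n (𝐬 n k) u → u ≡ (0 , 0 , 2 * k)) × (u ≡ (0 , 0 , 2 * k) → L u × Z n (𝐬 n k) u)
    L∩Z[𝐬]-if-[0,0,2]∈L L002 u = ⊆ u , λ { refl → [0,0,2k]∈L , φ[0,0,2k]≡𝐬 1≤n k }
      where
      ⊆ : ∀ u → L u × Z n (𝐬 n k) u → u ≡ (0 , 0 , 2 * k)
      ⊆ u (Lu , Zu) with L∩Z[𝐬]⊆ {k} 2k<n u Lu Zu
      ... | inj₁ refl = ⊥-elim ([3,1,0]∈L⇒[0,0,2]∉L (downClosed _ _ Lu (*-monoʳ-≤ 3 1≤k , 1≤k , z≤n)) L002)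
      ... | inj₂ u≡ = u≡
      [0,0,2k]∈L : L (0 , 0 , 2 * k)
      [0,0,2k]∈L with surjective _ 𝐬∈Ap
      ... | v , Lv , Zv = subst L (⊆ v (Lv , Zv)) Lv

odd⇒≡3+2q : ∀ {n} → 1 < n → n % 2 ≡ 1 → ∃ λ q → n ≡ 3 + 2 * q
odd⇒≡3+2q {n} 1<n n%2≡1 = from-quotient (n / 2) (trans (m≡m%n+[m/n]*n n 2) (cong (_+ n / 2 * 2) n%2≡1))
  where
  from-quotient : ∀ h → n ≡ 1 + h * 2 → ∃ λ q → n ≡ 3 + 2 * q
  from-quotient zero    n≡1      = ⊥-elim (<-irrefl refl (subst (1 <_) n≡1 1<n))
  from-quotient (suc h) n≡3+h*2 = h , trans n≡3+h*2 (cong (3 +_) (*-comm h 2))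

mainTheorem12 : (n : ℕ) → 5 ≤ n → n % 2 ≡ 1 →
  (f : ℕ) → IsFrobeniusT n f →
  (L : ℕ³ → Set) → IsLShape n f L →
  (i : ℕ) → 3 ≤ i → 2 * i + 1 ≤ n →
  ((∀ u → (Z n (3 * n + (3 * n ∸ 2)) u → (u ≡ (3 , 1 , 0) ⊎ u ≡ (0 , 0 , 2)))
          × ((u ≡ (3 , 1 , 0) ⊎ u ≡ (0 , 0 , 2)) → Z n (3 * n + (3 * n ∸ 2)) u))
   × (L (3 , 1 , 0) → ∀ u →
        ((L u × Z n (3 * (i ∸ 1) * n + (i ∸ 1) * (3 * n ∸ 2)) u) → u ≡ (3 * (i ∸ 1) , i ∸ 1 , 0))
        × (u ≡ (3 * (i ∸ 1) , i ∸ 1 , 0) → (L u × Z n (3 * (i ∸ 1) * n + (i ∸ 1) * (3 * n ∸ 2)) u)))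
   × (L (0 , 0 , 2) → ∀ u →
        ((L u × Z n (3 * (i ∸ 1) * n + (i ∸ 1) * (3 * n ∸ 2)) u) → u ≡ (0 , 0 , 2 * (i ∸ 1)))
        × (u ≡ (0 , 0 , 2 * (i ∸ 1)) → (L u × Z n (3 * (i ∸ 1) * n + (i ∸ 1) * (3 * n ∸ 2)) u)))
   × (∀ u → L u → Z n (3 * (i ∸ 1) * n + (i ∸ 1) * (3 * n ∸ 2)) u →
        (u ≡ (3 * (i ∸ 1) , i ∸ 1 , 0) ⊎ u ≡ (0 , 0 , 2 * (i ∸ 1)))))
mainTheorem12 n 5≤n n-odd f frob L isL (suc k) (s≤s 2≤k) 2i+1≤n
  with odd⇒≡3+2q (≤-trans (s≤s (s≤s z≤n)) 5≤n) n-odd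
... | q , refl with frobenius-unique frob (frobeniusNumber-isFrobenius q)
... | refl =
  factorizations-𝐬₁ (s≤s (s≤s (s≤s z≤n))) ,
  L∩Z[𝐬]-if-[3,1,0]∈L isL 1≤n 1≤k 2k<n (𝐬∈Ap q k≤q) ,
  L∩Z[𝐬]-if-[0,0,2]∈L isL 1≤n 1≤k 2k<n (𝐬∈Ap q k≤q) ,
  L∩Z[𝐬]⊆ isL 1≤n 2k<n
  where
  1≤n : 1 ≤ 3 + 2 * q
  1≤n = s≤s z≤n
  1≤k : 1 ≤ k
  1≤k = ≤-trans (n≤1+n 1) 2≤k
  k≤q : k ≤ q
  k≤q = *-cancelˡ-≤ 2 (+-cancelˡ-≤ 3 _ _ (subst (_≤ 3 + 2 * q) (regroup k) 2i+1≤n))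
    where
    regroup : ∀ k → 2 * suc k + 1 ≡ 3 + 2 * k
    regroup = solve-∀
  2k<n : 2 * k < 3 + 2 * q
  2k<n = ≤-trans (s≤s (*-monoʳ-≤ 2 k≤q)) (m≤n+m (suc (2 * q)) 2)
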